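{- Let $k\ge1$ and let $\pi\in\mathsf{S}_n$ have a strategic pile of size $k$. Then the number of merges of $\pi$ (the number of edges of its merge graph, i.e. the number of $b\in\mathsf{SP}(\pi)$ with $b+1\in\mathsf{SP}(\pi)$) is at most $k-1$ if $k$ is odd, and at most $k-2$ if $k$ is even.
   Context: $\mathsf{S}_n$: permutations of $\{1,\dots,n\}$, one-line notation $[a_1\cdots a_n]$; cycles $(c_1\cdots c_k)$ send $c_1\mapsto\cdots\mapsto c_k\mapsto c_1$; composition right-to-left. For $\pi=[a_1\cdots a_n]$ let $X_n=(0\;1\;\cdots\;n)$, $Y_\pi=(0\;a_n\;\cdots\;a_1)$, $C_\pi=Y_\pi\circ X_n$. If $0,n$ are in the same cycle of $C_\pi$, written $(0\;u_1\cdots u_j\;n\;b_1\cdots b_k)$, then $\mathsf{SP}(\pi)=\{b_1,\dots,b_k\}$; otherwise $\mathsf{SP}(\pi)=\emptyset$. The merge graph of $\pi$ is the directed graph on vertex set $\{b_1,\dots,b_k\}$ with an edge $(b_i,b_j)$ iff $b_i+1=b_j$; its edges are the merges of $\pi$. -}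

module Defs where

open import Data.Nat using (ℕ; zero; suc; _≡ᵇ_; _≟_)
open import Data.Bool using (if_then_else_)
open import Data.List using (List; []; _∷_; reverse; upTo; map; takeWhile; dropWhile; length; filter; drop)
open import Data.List.Membership.DecPropositional (_≟_) using (_∈?_)
open import Relation.Nullary.Decidable using (¬?)

-- The cyclic permutation (c₁ c₂ ⋯ c_k) of ℕ: c₁ ↦ c₂ ↦ ⋯ ↦ c_k ↦ c₁,
-- every other number fixed.
cycleFrom : ℕ → List ℕ → ℕ → ℕ
cycleFrom first [] x = x
cycleFrom first (a ∷ []) x = if a ≡ᵇ x then first else x
cycleFrom first (a ∷ b ∷ rest) x = if a ≡ᵇ x then b else cycleFrom first (b ∷ rest) x

cyc : List ℕ → ℕ → ℕ
cyc [] x = x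
cyc (c ∷ cs) x = cycleFrom c (c ∷ cs) x

X : ℕ → ℕ → ℕ
X n = cyc (upTo (suc n))

-- Y_π = (0 a_n ⋯ a_1) for π = [a_1 ⋯ a_n] in one-line notation
Y : List ℕ → ℕ → ℕ
Y π = cyc (0 ∷ reverse π)

C : ℕ → List ℕ → ℕ → ℕ
C n π x = Y π (X n x)

iter : (ℕ → ℕ) → ℕ → ℕ → ℕ
iter f zero x = x
iter f (suc m) x = f (iter f m x)

-- The cycle of C_π containing 0, listed starting at 0: 0, C 0, C² 0, …
-- up to (excluding) the return to 0.  C_π permutes {0,…,n}, so the
-- cycle has length ≤ n+1 and n iterates suffice.
cycleOf0 : ℕ → List ℕ → List ℕ
cycleOf0 n π =
  0 ∷ takeWhile (λ x → ¬? (x ≟ 0)) (map (λ i → iter (C n π) (suc i) 0) (upTo n))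

-- SP(π): if the cycle of 0 is (0 u₁ ⋯ u_j n b₁ ⋯ b_k), the list b₁ ⋯ b_k;
-- if n is not in the cycle of 0, dropWhile yields [] and SP is empty.
SP : ℕ → List ℕ → List ℕ
SP n π = drop 1 (dropWhile (λ x → ¬? (x ≟ n)) (cycleOf0 n π))

merges : ℕ → List ℕ → ℕ
merges n π = length (filter (λ b → suc b ∈? SP n π) (SP n π))

{-# OPTIONS --safe #-}
-- Write the cycle of C_π through 0 as (0 u₁ ⋯ u_j n b₁ ⋯ b_k). The largest bᵢ has no successor in
-- SP(π), so there are at most k - 1 merges, and if there are k - 1 then SP(π) is an interval
-- {c, …, c + k - 1}. Since C_π b = Y_π (b + 1) for b < n and C_π n = Y_π 0, on G = {0} ∪ SP(π) the map
-- Y_π agrees, except at c, with τ ∘ σ, where τ is the (k + 1)-cycle (0 b₁ ⋯ b_k) and σ is the k-cycle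
-- x ↦ x - 1 on the interval (c ↦ c + k - 1) fixing 0. As Y_π is a single cycle on {0, …, n}, iterating it
-- from any point of G reaches c without leaving G, so τ ∘ σ is a single (k + 1)-cycle too. Comparing
-- signs, (-1)^k = (-1)^k (-1)^(k-1), hence k is odd.
module Submission where

open import Defs
open import Data.Nat using (ℕ; suc; _≤_; _∸_; _%_)
open import Data.List using (List; length; upTo; map)
open import Data.List.Relation.Binary.Permutation.Propositional using (_↭_)
open import Relation.Binary.PropositionalEquality using (_≡_)
open import Data.Product using (_×_)

import Data.Nat.Properties as ℕ
open import Algebra.Properties.CommutativeMonoid.Sum ℕ.+-0-commutativeMonoid
  using (sum-syntax; sum-cong-≗; sum-replicate-zero; ∑-distrib-+; ∑-comm; ∑-permute)
open import Data.Bool.Base using (Bool; true; false; not; _∧_; _xor_)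
open import Data.Bool.Properties using (T-≡; xor-same; ∧-zeroʳ)
open import Data.Empty using (⊥-elim)
open import Data.Fin.Base as Fin using (Fin; zero; suc; toℕ; fromℕ; inject₁; lift; punchOut)
import Data.Fin.Properties as Fin
open import Data.Fin.Permutation as Perm using (Permutation′)
open import Data.List.Base using ([]; _∷_; _++_; [_]; applyUpTo; reverse; takeWhile; dropWhile; drop; filter)
open import Data.List.Extrema.Nat using (max; min; argmax-sel; argmin-sel; xs≤max; min≤xs; v≤max⁺; min≤v⁺)
open import Data.List.Membership.Propositional using (_∈_; _∉_)
import Data.List.Membership.Propositional.Properties as ∈
open import Data.List.Membership.DecPropositional ℕ._≟_ using (_∈?_)
import Data.List.Properties as List
open import Data.List.Relation.Binary.Permutation.Propositional using (↭-sym; ↭-trans; ↭-prep; ↭-reflexive; ↭⇒↭ₛ)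
import Data.List.Relation.Binary.Permutation.Propositional as ↭
import Data.List.Relation.Binary.Permutation.Propositional.Properties as ↭
import Data.List.Relation.Unary.AllPairs as AllPairs
open import Data.List.Relation.Unary.All as All using (All; []; _∷_)
open import Data.List.Relation.Unary.All.Properties using (¬Any⇒All¬; all-takeWhile)
open import Data.List.Relation.Unary.Any as Any using (here; there)
open import Data.List.Relation.Unary.Unique.Propositional using (Unique; []; _∷_)
import Data.List.Relation.Unary.Unique.Propositional.Properties as Unique
open import Data.Nat.Base using (zero; pred; _+_; _*_; _<ᵇ_; _≡ᵇ_; _<_; z≤n; s≤s; parity)
open import Data.Nat.Properties using (_≟_)
open import Data.Nat.DivMod using ([m+n]%n≡m%n)
open import Data.Nat.GeneralisedArithmetic using (fold; fold-+; iterate-is-fold)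
open import Data.Nat.Tactic.RingSolver using (solve-∀)
open import Data.Parity.Base as ℙ using (Parity; 0ℙ; 1ℙ; _⁻¹)
import Data.Parity.Properties as ℙ
open import Data.Product using (∃; _,_; proj₁; proj₂)
open import Data.Sum.Base using (_⊎_; inj₁; inj₂)
open import Function.Base using (_∘_)
open import Function.Bundles using (Equivalence; _⇔_; mk⇔)
open import Function.Definitions using (Injective)
open import Relation.Binary.Definitions using (tri<; tri≈; tri>)
open import Relation.Binary.PropositionalEquality hiding ([_])
open import Data.List.Relation.Binary.Permutation.Setoid.Properties (setoid ℕ) using (Unique-resp-↭)
open import Relation.Nullary using (¬_; does; yes; no)
open import Relation.Nullary.Decidable using (¬?)
open import Relation.Unary using (Pred; Decidable)

-- Signs of permutations of Fin m

⟦_⟧ : Bool → ℕ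
⟦ true ⟧ = 1
⟦ false ⟧ = 0

module _ {m : ℕ} where

  _<ᶠ_ : Fin m → Fin m → Bool
  i <ᶠ j = toℕ i <ᵇ toℕ j

  Inverts : (Fin m → Fin m) → Fin m → Fin m → Bool
  Inverts f i j = not (does (i Fin.≟ j)) ∧ (i <ᶠ j xor f i <ᶠ f j)

  ∑∑ : (Fin m → Fin m → ℕ) → ℕ
  ∑∑ S = ∑[ i < m ] ∑[ j < m ] S i j

  ∑∑< : (Fin m → Fin m → ℕ) → ℕ
  ∑∑< S = ∑∑ (λ i j → ⟦ i <ᶠ j ⟧ * S i j)

  inversions : (Fin m → Fin m) → ℕ
  inversions f = ∑∑< (λ i j → ⟦ Inverts f i j ⟧)

  sign : (Fin m → Fin m) → Parity
  sign f = parity (inversions f)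

  ∑∑-cong : ∀ {S T : Fin m → Fin m → ℕ} → (∀ i j → S i j ≡ T i j) → ∑∑ S ≡ ∑∑ T
  ∑∑-cong S≡T = sum-cong-≗ (λ i → sum-cong-≗ (S≡T i))

  ∑∑-distrib-+ : ∀ (S T : Fin m → Fin m → ℕ) → ∑∑ (λ i j → S i j + T i j) ≡ ∑∑ S + ∑∑ T
  ∑∑-distrib-+ S T = trans (sum-cong-≗ (λ i → ∑-distrib-+ (S i) (T i)))
                           (∑-distrib-+ (λ i → ∑[ j < m ] S i j) (λ i → ∑[ j < m ] T i j))

  <ᶠ-asym : ∀ {i j : Fin m} → i ≢ j → j <ᶠ i ≡ not (i <ᶠ j)
  <ᶠ-asym {i} {j} i≢j = go (toℕ i) (toℕ j) (i≢j ∘ Fin.toℕ-injective)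
    where
    go : ∀ a b → a ≢ b → (b <ᵇ a) ≡ not (a <ᵇ b)
    go zero zero a≢b = ⊥-elim (a≢b refl)
    go zero (suc b) _ = refl
    go (suc a) zero _ = refl
    go (suc a) (suc b) a≢b = go a b (a≢b ∘ cong suc)

  <ᶠ-irrefl : ∀ (i : Fin m) → i <ᶠ i ≡ false
  <ᶠ-irrefl i = go (toℕ i)
    where
    go : ∀ a → (a <ᵇ a) ≡ false
    go zero = refl
    go (suc a) = go a

  ∑∑-symmetric : ∀ (S : Fin m → Fin m → ℕ) → (∀ i j → S i j ≡ S j i) → (∀ i → S i i ≡ 0) →
                 ∑∑ S ≡ ∑∑< S + ∑∑< S
  ∑∑-symmetric S sym-S diag-S = begin
    ∑∑ S                                ≡⟨ ∑∑-cong split ⟩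
    ∑∑ (λ i j → A i j + A j i)          ≡⟨ ∑∑-distrib-+ A (λ i j → A j i) ⟩
    ∑∑ A + ∑∑ (λ i j → A j i)           ≡⟨ cong (∑∑ A +_) (∑-comm (λ i j → A j i)) ⟩
    ∑∑ A + ∑∑ A                         ∎
    where
    open ≡-Reasoning
    A : Fin m → Fin m → ℕ
    A i j = ⟦ i <ᶠ j ⟧ * S i j
    split : ∀ i j → S i j ≡ A i j + A j i
    split i j with i Fin.≟ j
    ... | yes refl rewrite <ᶠ-irrefl i | diag-S i = refl
    ... | no i≢j rewrite <ᶠ-asym i≢j with i <ᶠ j
    ...   | true = sym (trans (ℕ.+-identityʳ _) (ℕ.+-identityʳ _))
    ...   | false = trans (sym-S i j) (sym (ℕ.+-identityʳ _))

  Inverts-diag : ∀ f i → Inverts f i i ≡ false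
  Inverts-diag f i with i Fin.≟ i
  ... | yes _ = refl
  ... | no i≢i = ⊥-elim (i≢i refl)

  Inverts-sym : ∀ {f} → Injective _≡_ _≡_ f → ∀ i j → Inverts f i j ≡ Inverts f j i
  Inverts-sym {f} f-inj i j with i Fin.≟ j | j Fin.≟ i
  ... | yes _ | yes _ = refl
  ... | yes i≡j | no j≢i = ⊥-elim (j≢i (sym i≡j))
  ... | no i≢j | yes j≡i = ⊥-elim (i≢j (sym j≡i))
  ... | no i≢j | no _ rewrite <ᶠ-asym i≢j | <ᶠ-asym (i≢j ∘ f-inj) =
    not-xor-not (i <ᶠ j) (f i <ᶠ f j)
    where
    not-xor-not : ∀ a b → a xor b ≡ not a xor not b
    not-xor-not true true = refl
    not-xor-not true false = refl
    not-xor-not false true = refl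
    not-xor-not false false = refl

  double-inversions : ∀ {f} → Injective _≡_ _≡_ f →
                      ∑∑ (λ i j → ⟦ Inverts f i j ⟧) ≡ inversions f + inversions f
  double-inversions {f} f-inj =
    ∑∑-symmetric _ (λ i j → cong ⟦_⟧ (Inverts-sym f-inj i j)) (λ i → cong ⟦_⟧ (Inverts-diag f i))

injective⇒surjective : ∀ {m} {f : Fin m → Fin m} → Injective _≡_ _≡_ f → ∀ y → ∃ λ x → f x ≡ y
injective⇒surjective {suc m} {f} f-inj y with Fin.any? (λ x → f x Fin.≟ y)
... | yes hit = hit
... | no miss = ⊥-elim (ℕ.<-irrefl refl (Fin.injective⇒≤ punched-injective))
  where
  y≢f : ∀ x → y ≢ f x
  y≢f x y≡fx = miss (x , sym y≡fx)
  punched : Fin (suc m) → Fin m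
  punched x = punchOut (y≢f x)
  punched-injective : Injective _≡_ _≡_ punched
  punched-injective eq = f-inj (Fin.punchOut-injective (y≢f _) (y≢f _) eq)

injective⇒permutation : ∀ {m} {f : Fin m → Fin m} → Injective _≡_ _≡_ f → Permutation′ m
injective⇒permutation {f = f} f-inj =
  Perm.permutation f (proj₁ ∘ surj) (proj₂ ∘ surj) (λ x → f-inj (proj₂ (surj (f x))))
  where surj = injective⇒surjective f-inj

module _ {m : ℕ} where

  ∑∑-reindex : ∀ {g : Fin m → Fin m} → Injective _≡_ _≡_ g → (S : Fin m → Fin m → ℕ) →
               ∑∑ (λ i j → S (g i) (g j)) ≡ ∑∑ S
  ∑∑-reindex {g} g-inj S = trans
    (sum-cong-≗ (λ i → sym (∑-permute (S (g i)) γ)))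
    (sym (∑-permute (λ i → ∑[ j < m ] S i j) γ))
    where γ = injective⇒permutation g-inj

  ≟-injective : ∀ {g : Fin m → Fin m} → Injective _≡_ _≡_ g →
                ∀ i j → does (g i Fin.≟ g j) ≡ does (i Fin.≟ j)
  ≟-injective {g} g-inj i j with i Fin.≟ j | g i Fin.≟ g j
  ... | yes _ | yes _ = refl
  ... | no _ | no _ = refl
  ... | yes i≡j | no gi≢gj = ⊥-elim (gi≢gj (cong g i≡j))
  ... | no i≢j | yes gi≡gj = ⊥-elim (i≢j (g-inj gi≡gj))

  -- a pair is inverted by f ∘ g iff it is inverted by exactly one of g and f
  Inverts-∘ : ∀ {f g : Fin m → Fin m} → Injective _≡_ _≡_ g → ∀ i j →
              let a = ⟦ Inverts g i j ⟧; b = ⟦ Inverts f (g i) (g j) ⟧ in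
              ⟦ Inverts (f ∘ g) i j ⟧ + (a * b + a * b) ≡ a + b
  Inverts-∘ {f} {g} g-inj i j rewrite ≟-injective g-inj i j =
    cases (not (does (i Fin.≟ j))) (i <ᶠ j) (g i <ᶠ g j) (f (g i) <ᶠ f (g j))
    where
    cases : ∀ d a b c → let x = ⟦ d ∧ (a xor b) ⟧; y = ⟦ d ∧ (b xor c) ⟧ in
                        ⟦ d ∧ (a xor c) ⟧ + (x * y + x * y) ≡ x + y
    cases false a b c = refl
    cases true true true true = refl
    cases true true true false = refl
    cases true true false true = refl
    cases true true false false = refl
    cases true false true true = refl
    cases true false true false = refl
    cases true false false true = refl
    cases true false false false = refl

  inversions-∘ : ∀ {f g : Fin m → Fin m} → Injective _≡_ _≡_ f → Injective _≡_ _≡_ g →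
                 ∃ λ q → inversions (f ∘ g) + 2 * q ≡ inversions f + inversions g
  inversions-∘ {f} {g} f-inj g-inj = q , ℕ.*-cancelˡ-≡ _ _ 2 doubled
    where
    open ≡-Reasoning
    I : (Fin m → Fin m) → Fin m → Fin m → ℕ
    I h i j = ⟦ Inverts h i j ⟧
    E : Fin m → Fin m → ℕ
    E i j = I g i j * I f (g i) (g j)
    q = ∑∑< E
    ∑∑E : ∑∑ E ≡ q + q
    ∑∑E = ∑∑-symmetric E
      (λ i j → cong₂ _*_ (cong ⟦_⟧ (Inverts-sym g-inj i j)) (cong ⟦_⟧ (Inverts-sym f-inj (g i) (g j))))
      (λ i → cong (_* I f (g i) (g i)) (cong ⟦_⟧ (Inverts-diag g i)))
    summed : ∑∑ (I (f ∘ g)) + (∑∑ E + ∑∑ E) ≡ ∑∑ (I g) + ∑∑ (I f)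
    summed = begin
      ∑∑ (I (f ∘ g)) + (∑∑ E + ∑∑ E)                ≡⟨ cong (∑∑ (I (f ∘ g)) +_) (∑∑-distrib-+ E E) ⟨
      ∑∑ (I (f ∘ g)) + ∑∑ (λ i j → E i j + E i j)   ≡⟨ ∑∑-distrib-+ (I (f ∘ g)) _ ⟨
      ∑∑ (λ i j → I (f ∘ g) i j + (E i j + E i j))  ≡⟨ ∑∑-cong (Inverts-∘ {f} g-inj) ⟩
      ∑∑ (λ i j → I g i j + I f (g i) (g j))        ≡⟨ ∑∑-distrib-+ (I g) (λ i j → I f (g i) (g j)) ⟩
      ∑∑ (I g) + ∑∑ (λ i j → I f (g i) (g j))       ≡⟨ cong (∑∑ (I g) +_) (∑∑-reindex g-inj (I f)) ⟩
      ∑∑ (I g) + ∑∑ (I f)                           ∎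
    doubled : 2 * (inversions (f ∘ g) + 2 * q) ≡ 2 * (inversions f + inversions g)
    doubled = begin
      2 * (inversions (f ∘ g) + 2 * q)
        ≡⟨ double-both (inversions (f ∘ g)) q ⟩
      (inversions (f ∘ g) + inversions (f ∘ g)) + ((q + q) + (q + q))
        ≡⟨ cong₂ (λ a b → a + (b + b)) (double-inversions (g-inj ∘ f-inj)) ∑∑E ⟨
      ∑∑ (I (f ∘ g)) + (∑∑ E + ∑∑ E)
        ≡⟨ summed ⟩
      ∑∑ (I g) + ∑∑ (I f)
        ≡⟨ cong₂ _+_ (double-inversions g-inj) (double-inversions f-inj) ⟩
      (inversions g + inversions g) + (inversions f + inversions f)
        ≡⟨ collect (inversions g) (inversions f) ⟩
      2 * (inversions f + inversions g) ∎
      where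
      double-both : ∀ a b → 2 * (a + 2 * b) ≡ (a + a) + ((b + b) + (b + b))
      double-both = solve-∀
      collect : ∀ a b → (a + a) + (b + b) ≡ 2 * (b + a)
      collect = solve-∀

  sign-∘ : ∀ {f g : Fin m → Fin m} → Injective _≡_ _≡_ f → Injective _≡_ _≡_ g →
           sign (f ∘ g) ≡ sign f ℙ.+ sign g
  sign-∘ {f} {g} f-inj g-inj with inversions-∘ f-inj g-inj
  ... | q , eq = begin
    sign (f ∘ g)                         ≡⟨ ℙ.+-identityʳ _ ⟨
    sign (f ∘ g) ℙ.+ 0ℙ                  ≡⟨ cong (sign (f ∘ g) ℙ.+_) (ℙ.*-homo-* 2 q) ⟨
    sign (f ∘ g) ℙ.+ parity (2 * q)      ≡⟨ ℙ.+-homo-+ (inversions (f ∘ g)) (2 * q) ⟨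
    parity (inversions (f ∘ g) + 2 * q)  ≡⟨ cong parity eq ⟩
    parity (inversions f + inversions g) ≡⟨ ℙ.+-homo-+ (inversions f) (inversions g) ⟩
    sign f ℙ.+ sign g                    ∎
    where open ≡-Reasoning

  sign-cong : ∀ {f g : Fin m → Fin m} → (∀ x → f x ≡ g x) → sign f ≡ sign g
  sign-cong {f} {g} f≗g = cong parity (∑∑-cong (λ i j → cong (λ b → ⟦ i <ᶠ j ⟧ * ⟦ b ⟧) (Inverts≡ i j)))
    where
    Inverts≡ : ∀ i j → Inverts f i j ≡ Inverts g i j
    Inverts≡ i j rewrite f≗g i | f≗g j = refl

  -- with parities every sign is its own inverse, so no inverse of γ is needed
  sign-conj : ∀ {f γ r : Fin m → Fin m} →
              Injective _≡_ _≡_ f → Injective _≡_ _≡_ γ → Injective _≡_ _≡_ r →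
              (∀ x → f (γ (r x)) ≡ γ x) → sign f ≡ sign r
  sign-conj {f} {γ} {r} f-inj γ-inj r-inj f∘γ∘r≗γ = sum≡0⇒≡ (ℙ.+-cancelʳ-≡ (sign γ) _ _ (begin
    (sign f ℙ.+ sign r) ℙ.+ sign γ     ≡⟨ rearrange (sign f) (sign r) (sign γ) ⟩
    sign f ℙ.+ (sign γ ℙ.+ sign r)     ≡⟨ cong (sign f ℙ.+_) (sign-∘ γ-inj r-inj) ⟨
    sign f ℙ.+ sign (γ ∘ r)            ≡⟨ sign-∘ f-inj (r-inj ∘ γ-inj) ⟨
    sign (f ∘ γ ∘ r)                   ≡⟨ sign-cong f∘γ∘r≗γ ⟩
    sign γ                             ∎))
    where
    open ≡-Reasoning
    rearrange : ∀ a b c → (a ℙ.+ b) ℙ.+ c ≡ a ℙ.+ (c ℙ.+ b)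
    rearrange a b c = trans (ℙ.+-assoc a b c) (cong (a ℙ.+_) (ℙ.+-comm b c))
    sum≡0⇒≡ : ∀ {a b} → a ℙ.+ b ≡ 0ℙ → a ≡ b
    sum≡0⇒≡ {0ℙ} {0ℙ} _ = refl
    sum≡0⇒≡ {1ℙ} {1ℙ} _ = refl

∑-zero : ∀ {n} {f : Fin n → ℕ} → (∀ j → f j ≡ 0) → ∑[ j < n ] f j ≡ 0
∑-zero {n} f≗0 = trans (sum-cong-≗ f≗0) (sum-replicate-zero n)

∑-ones : ∀ n → ∑[ j < n ] 1 ≡ n
∑-ones zero = refl
∑-ones (suc n) = cong suc (∑-ones n)

inversions-lift : ∀ {m} (f : Fin m → Fin m) → inversions (lift 1 f) ≡ inversions f
inversions-lift {m} f = cong (_+ inversions f) (∑-zero {m} (λ _ → refl))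

sign-lift : ∀ {m} (f : Fin m → Fin m) → sign (lift 1 f) ≡ sign f
sign-lift f = cong parity (inversions-lift f)

rotate : ∀ {m} → Fin (suc m) → Fin (suc m)
rotate {m} zero = fromℕ m
rotate (suc i) = inject₁ i

rotate-injective : ∀ {m} → Injective _≡_ _≡_ (rotate {m})
rotate-injective {x = zero} {zero} _ = refl
rotate-injective {x = zero} {suc y} eq = ⊥-elim (Fin.fromℕ≢inject₁ eq)
rotate-injective {x = suc x} {zero} eq = ⊥-elim (Fin.fromℕ≢inject₁ (sym eq))
rotate-injective {x = suc x} {suc y} eq = cong suc (Fin.inject₁-injective eq)

inversions-rotate : ∀ m → inversions (rotate {m}) ≡ m
inversions-rotate m =
  trans (cong₂ _+_ (trans (sum-cong-≗ wraps) (∑-ones m)) (∑-zero (λ i → ∑-zero (later i))))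
        (ℕ.+-identityʳ m)
  where
  wraps : ∀ j → ⟦ zero <ᶠ suc j ⟧ * ⟦ Inverts (rotate {m}) zero (suc j) ⟧ ≡ 1
  wraps j rewrite Fin.toℕ-fromℕ m with m <ᵇ toℕ (inject₁ j) | ℕ.<ᵇ⇒< m (toℕ (inject₁ j))
  ... | false | _ = refl
  ... | true | m<j = ⊥-elim (ℕ.<-asym (m<j _) (subst (_< m) (sym (Fin.toℕ-inject₁ j)) (Fin.toℕ<n j)))
  later : ∀ i j → ⟦ suc i <ᶠ j ⟧ * ⟦ Inverts (rotate {m}) (suc i) j ⟧ ≡ 0
  later i zero = refl
  later i (suc j) rewrite Fin.toℕ-inject₁ i | Fin.toℕ-inject₁ j | xor-same (toℕ i <ᵇ toℕ j)
                        | ∧-zeroʳ (not (does (suc i Fin.≟ suc j))) = ℕ.*-zeroʳ ⟦ toℕ i <ᵇ toℕ j ⟧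

sign-rotate : ∀ m → sign (rotate {m}) ≡ parity m
sign-rotate m = cong parity (inversions-rotate m)

-- Cyclic permutations of Fin m

fold-suc : ∀ {A : Set} (f : A → A) x t → fold x f (suc t) ≡ fold (f x) f t
fold-suc f x t = trans (iterate-is-fold x f (suc t)) (sym (iterate-is-fold (f x) f t))

Cyclic : ∀ {m} → (Fin m → Fin m) → Set
Cyclic f = ∃ λ p → ∀ x → ∃ λ t → fold x f t ≡ p

module _ {m} {f : Fin (suc m) → Fin (suc m)} (f-inj : Injective _≡_ _≡_ f) where

  fold-injective : ∀ t → Injective _≡_ _≡_ (λ x → fold x f t)
  fold-injective zero eq = eq
  fold-injective (suc t) eq = fold-injective t (f-inj eq)

  module Orbit {p} (reaches : ∀ x → ∃ λ t → fold x f t ≡ p) where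

    orbit-below : ∀ {d} → 0 < d → fold p f d ≡ p → ∀ t x → fold x f t ≡ p →
                  ∃ λ e → e < d × fold p f e ≡ x
    orbit-below 0<d _ zero x x≡p = 0 , 0<d , sym x≡p
    orbit-below {d} 0<d periodic (suc t) x reached
      with orbit-below 0<d periodic t (f x) (trans (sym (fold-suc f x t)) reached)
    ... | suc e , e<d , fᵉ⁺¹p≡fx = e , ℕ.<-trans (ℕ.n<1+n e) e<d , f-inj fᵉ⁺¹p≡fx
    ... | zero , _ , p≡fx with d | periodic
    ...   | suc d′ | fᵈp≡p = d′ , ℕ.n<1+n d′ , f-inj (trans fᵈp≡p p≡fx)

    period-≥ : ∀ {d} → 0 < d → fold p f d ≡ p → suc m ≤ d
    period-≥ {d} 0<d periodic = Fin.injective⇒≤ exponent-injective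
      where
      below : ∀ x → ∃ λ e → e < d × fold p f e ≡ x
      below x = orbit-below 0<d periodic (proj₁ (reaches x)) x (proj₂ (reaches x))
      exponent : Fin (suc m) → Fin d
      exponent x = Fin.fromℕ< (proj₁ (proj₂ (below x)))
      exponent-injective : Injective _≡_ _≡_ exponent
      exponent-injective {x} {y} eq = begin
        x                            ≡⟨ proj₂ (proj₂ (below x)) ⟨
        fold p f (proj₁ (below x))   ≡⟨ cong (fold p f) (Fin.fromℕ<-injective _ _ _ _ eq) ⟩
        fold p f (proj₁ (below y))   ≡⟨ proj₂ (proj₂ (below y)) ⟩
        y                            ∎
        where open ≡-Reasoning

    shift-period : ∀ a c → fold p f a ≡ fold p f (a + c) → fold p f c ≡ p
    shift-period a c eq = sym (fold-injective a (trans eq (fold-+ p f a)))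

    period : fold p f (suc m) ≡ p
    period with Fin.pigeonhole (ℕ.n<1+n (suc m)) (λ (i : Fin (suc (suc m))) → fold p f (toℕ i))
    ... | i , j , i<j , fⁱp≡fʲp = subst (λ d → fold p f d ≡ p) d≡suc-m fᵈp≡p
      where
      d = toℕ j ∸ toℕ i
      fᵈp≡p : fold p f d ≡ p
      fᵈp≡p = shift-period (toℕ i) d (trans fⁱp≡fʲp (cong (fold p f) (sym (ℕ.m+[n∸m]≡n (ℕ.<⇒≤ i<j)))))
      d≡suc-m : d ≡ suc m
      d≡suc-m = ℕ.≤-antisym (ℕ.≤-trans (ℕ.m∸n≤m (toℕ j) (toℕ i)) (ℕ.≤-pred (Fin.toℕ<n j)))
                            (period-≥ (ℕ.m<n⇒0<n∸m i<j) fᵈp≡p)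

    orbit : Fin (suc m) → Fin (suc m)
    orbit i = fold p f (toℕ i)

    no-short-period : ∀ {a b} → a < b → b ≤ m → fold p f a ≢ fold p f b
    no-short-period {a} {b} a<b b≤m fᵃp≡fᵇp = ℕ.<-irrefl refl (ℕ.≤-trans (period-≥ 0<c fᶜp≡p) c≤m)
      where
      c = b ∸ a
      0<c : 0 < c
      0<c = ℕ.m<n⇒0<n∸m a<b
      c≤m : c ≤ m
      c≤m = ℕ.≤-trans (ℕ.m∸n≤m b a) b≤m
      fᶜp≡p : fold p f c ≡ p
      fᶜp≡p = shift-period a c (trans fᵃp≡fᵇp (cong (fold p f) (sym (ℕ.m+[n∸m]≡n (ℕ.<⇒≤ a<b)))))

    orbit-injective : Injective _≡_ _≡_ orbit
    orbit-injective {i} {j} eq with ℕ.<-cmp (toℕ i) (toℕ j)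
    ... | tri≈ _ i≡j _ = Fin.toℕ-injective i≡j
    ... | tri< i<j _ _ = ⊥-elim (no-short-period i<j (Fin.toℕ≤pred[n] j) eq)
    ... | tri> _ _ j<i = ⊥-elim (no-short-period j<i (Fin.toℕ≤pred[n] i) (sym eq))

    orbit-rotate : ∀ i → f (orbit (rotate i)) ≡ orbit i
    orbit-rotate zero = trans (cong (λ t → fold p f (suc t)) (Fin.toℕ-fromℕ m)) period
    orbit-rotate (suc i) = cong (λ t → fold p f (suc t)) (Fin.toℕ-inject₁ i)

  sign-cyclic : Cyclic f → sign f ≡ parity m
  sign-cyclic (p , reaches) =
    trans (sign-conj f-inj orbit-injective rotate-injective orbit-rotate) (sign-rotate m)
    where open Orbit reaches

cyclic-∘-lift-rotate : ∀ {m} {f : Fin (suc (suc m)) → Fin (suc (suc m))} → Injective _≡_ _≡_ f →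
                       Cyclic f → Cyclic (f ∘ lift 1 rotate) → parity m ≡ 0ℙ
cyclic-∘-lift-rotate {m} {f} f-inj f-cyclic f∘σ-cyclic = ℙ.+-cancelˡ-≡ (parity (suc m)) (parity m) 0ℙ (begin
  parity (suc m) ℙ.+ parity m              ≡⟨ cong₂ ℙ._+_ (sign-cyclic f-inj f-cyclic) (sign-rotate m) ⟨
  sign f ℙ.+ sign (rotate {m})             ≡⟨ cong (sign f ℙ.+_) (sign-lift (rotate {m})) ⟨
  sign f ℙ.+ sign (lift 1 (rotate {m}))    ≡⟨ sign-∘ f-inj σ-inj ⟨
  sign (f ∘ lift 1 rotate)                 ≡⟨ sign-cyclic (σ-inj ∘ f-inj) f∘σ-cyclic ⟩
  parity (suc m)                           ≡⟨ ℙ.+-identityʳ (parity (suc m)) ⟨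
  parity (suc m) ℙ.+ 0ℙ                    ∎)
  where
  open ≡-Reasoning
  σ-inj = Fin.lift-injective rotate rotate-injective 1

iter≡fold : ∀ f t x → iter f t x ≡ fold x f t
iter≡fold f zero x = refl
iter≡fold f (suc t) x = cong f (iter≡fold f t x)

≡ᵇ-true : ∀ {a b} → a ≡ b → (a ≡ᵇ b) ≡ true
≡ᵇ-true {a} {b} a≡b = Equivalence.to T-≡ (ℕ.≡⇒≡ᵇ a b a≡b)

≡ᵇ-false : ∀ {a b} → a ≢ b → (a ≡ᵇ b) ≡ false
≡ᵇ-false {a} {b} a≢b with a ≡ᵇ b in eq
... | true = ⊥-elim (a≢b (ℕ.≡ᵇ⇒≡ a b (Equivalence.from T-≡ eq)))
... | false = refl

record Permutes (n : ℕ) (f : ℕ → ℕ) : Set where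
  field
    closed : ∀ {x} → x ≤ n → f x ≤ n
    injective : ∀ {x y} → x ≤ n → y ≤ n → f x ≡ f y → x ≡ y

module _ {n f} (perm : Permutes n f) where
  open Permutes perm

  Permutes-∘ : ∀ {g} → Permutes n g → Permutes n (f ∘ g)
  Permutes-∘ perm-g = record
    { closed = closed ∘ G.closed
    ; injective = λ x≤n y≤n → G.injective x≤n y≤n ∘ injective (G.closed x≤n) (G.closed y≤n)
    }
    where module G = Permutes perm-g

  fold-closed : ∀ t {x} → x ≤ n → fold x f t ≤ n
  fold-closed zero x≤n = x≤n
  fold-closed (suc t) x≤n = closed (fold-closed t x≤n)

  fold-injectiveOn : ∀ t {x y} → x ≤ n → y ≤ n → fold x f t ≡ fold y f t → x ≡ y
  fold-injectiveOn zero _ _ eq = eq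
  fold-injectiveOn (suc t) x≤n y≤n eq =
    fold-injectiveOn t x≤n y≤n (injective (fold-closed t x≤n) (fold-closed t y≤n) eq)

  returns : ∀ {x} → x ≤ n → ∃ λ i → i ≤ n × fold x f (suc i) ≡ x
  returns {x} x≤n with Fin.pigeonhole (ℕ.n<1+n (suc n)) (λ i → Fin.fromℕ< (s≤s (fold-closed (toℕ i) x≤n)))
  ... | i , j , i<j , eq = as-return d (ℕ.m<n⇒0<n∸m i<j) d≤suc-n (sym x≡fᵈx)
    where
    d = toℕ j ∸ toℕ i
    d≤suc-n : d ≤ suc n
    d≤suc-n = ℕ.≤-trans (ℕ.m∸n≤m (toℕ j) (toℕ i)) (Fin.toℕ≤pred[n] j)
    x≡fᵈx : x ≡ fold x f d
    x≡fᵈx = fold-injectiveOn (toℕ i) x≤n (fold-closed d x≤n) (begin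
      fold x f (toℕ i)             ≡⟨ Fin.fromℕ<-injective _ _ _ _ eq ⟩
      fold x f (toℕ j)             ≡⟨ cong (fold x f) (ℕ.m+[n∸m]≡n (ℕ.<⇒≤ i<j)) ⟨
      fold x f (toℕ i + d)         ≡⟨ fold-+ x f (toℕ i) ⟩
      fold (fold x f d) f (toℕ i)  ∎)
      where open ≡-Reasoning
    as-return : ∀ d → 0 < d → d ≤ suc n → fold x f d ≡ x → ∃ λ i → i ≤ n × fold x f (suc i) ≡ x
    as-return (suc d) _ (s≤s d≤n) fᵈx≡x = d , d≤n , fᵈx≡x

Chain : (ℕ → ℕ) → ℕ → List ℕ → ℕ → Set
Chain f x [] y = f x ≡ y
Chain f x (b ∷ l) y = f x ≡ b × Chain f b l y

module _ {f : ℕ → ℕ} where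

  Chain-cong : ∀ {g x x′ l y} → f x ≡ g x′ → (∀ {z} → z ∈ l → f z ≡ g z) →
               Chain f x l y → Chain g x′ l y
  Chain-cong {l = []} fx≡gx′ _ fx≡y = trans (sym fx≡gx′) fx≡y
  Chain-cong {l = b ∷ l} fx≡gx′ f≗g (fx≡b , chain) =
    trans (sym fx≡gx′) fx≡b , Chain-cong (f≗g (here refl)) (f≗g ∘ there) chain

  Chain-split : ∀ {x l y} p {z} r → x ∷ l ≡ p ++ z ∷ r → Chain f x l y → Chain f z r y
  Chain-split [] r refl chain = chain
  Chain-split (_ ∷ []) r refl (refl , chain) = chain
  Chain-split (_ ∷ p@(_ ∷ _)) r refl (refl , chain) = Chain-split p r refl chain

  Chain-step : ∀ {x l y z} → Chain f x l y → z ∈ x ∷ l → f z ∈ l ⊎ f z ≡ y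
  Chain-step {l = []} fx≡y (here refl) = inj₂ fx≡y
  Chain-step {l = b ∷ l} (fx≡b , _) (here refl) = inj₁ (here fx≡b)
  Chain-step {l = b ∷ l} (_ , chain) (there z∈l) with Chain-step chain z∈l
  ... | inj₁ fz∈l = inj₁ (there fz∈l)
  ... | inj₂ fz≡y = inj₂ fz≡y

  Chain-predecessor : ∀ {x l y z} → Chain f x l y → z ∈ l → ∃ λ w → w ∈ x ∷ l × f w ≡ z
  Chain-predecessor {x} (fx≡b , _) (here refl) = x , here refl , fx≡b
  Chain-predecessor {l = _ ∷ l} (_ , chain) (there z∈l) with Chain-predecessor chain z∈l
  ... | w , w∈ , fw≡z = w , there w∈ , fw≡z

  Chain-toEnd : ∀ {x l y z} → Chain f x l y → z ∈ x ∷ l → ∃ λ t → fold z f (suc t) ≡ y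
  Chain-toEnd {l = []} fx≡y (here refl) = 0 , fx≡y
  Chain-toEnd {x} {l = b ∷ l} (fx≡b , chain) (here refl) with Chain-toEnd chain (here refl)
  ... | t , fᵗ⁺¹b≡y = suc t , trans (fold-suc f x (suc t)) (trans (cong (λ w → fold w f (suc t)) fx≡b) fᵗ⁺¹b≡y)
  Chain-toEnd {l = b ∷ l} (_ , chain) (there z∈l) = Chain-toEnd chain z∈l

  Chain-fromStart : ∀ {x l y z} → Chain f x l y → z ∈ l → ∃ λ t → fold x f t ≡ z
  Chain-fromStart (fx≡b , _) (here refl) = 1 , fx≡b
  Chain-fromStart {x} {l = b ∷ l} (fx≡b , chain) (there z∈l) with Chain-fromStart chain z∈l
  ... | t , fᵗb≡z = suc t , trans (fold-suc f x t) (trans (cong (λ w → fold w f t) fx≡b) fᵗb≡z)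

  Chain-unique : ∀ {x l y} → (∀ {a b} → a ∈ x ∷ l → b ∈ x ∷ l → f a ≡ f b → a ≡ b) →
                 Chain f x l y → x ∉ l → Unique (x ∷ l)
  Chain-unique {l = []} _ _ _ = [] ∷ []
  Chain-unique {x} {l = b ∷ l} inj (fx≡b , chain) x∉l =
    ¬Any⇒All¬ (b ∷ l) x∉l ∷ Chain-unique (λ a∈ b∈ → inj (there a∈) (there b∈)) chain b∉l
    where
    b∉l : b ∉ l
    b∉l b∈l with Chain-predecessor chain b∈l
    ... | w , w∈ , fw≡b = x∉l (subst (_∈ b ∷ l) (inj (there w∈) (here refl) (trans fw≡b (sym fx≡b))) w∈)

  Chain-takeWhile : ∀ {g : ℕ → ℕ} {z x} m {i} → (∀ j → g (suc j) ≡ f (g j)) → f z ≡ g 0 →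
                    i ≤ m → g i ≡ x → Chain f z (takeWhile (λ y → ¬? (y ≟ x)) (applyUpTo g m)) x
  Chain-takeWhile zero _ fz≡g₀ z≤n g₀≡x = trans fz≡g₀ g₀≡x
  Chain-takeWhile {g} {x = x} (suc m) {i} step fz≡g₀ i≤m gᵢ≡x with g 0 ≟ x
  ... | yes g₀≡x rewrite ≡ᵇ-true g₀≡x = trans fz≡g₀ g₀≡x
  ... | no g₀≢x rewrite ≡ᵇ-false g₀≢x with i | i≤m | gᵢ≡x
  ...   | zero | _ | g₀≡x = ⊥-elim (g₀≢x g₀≡x)
  ...   | suc i | s≤s i≤m | gᵢ₊₁≡x =
    fz≡g₀ , Chain-takeWhile m (step ∘ suc) (sym (step 0)) i≤m gᵢ₊₁≡x

-- The cyclic permutations X_n and Y_π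

cycleFrom-head : ∀ f a b r → cycleFrom f (a ∷ b ∷ r) a ≡ b
cycleFrom-head f a b r rewrite ≡ᵇ-true {a} refl = refl

cycleFrom-last : ∀ f a → cycleFrom f [ a ] a ≡ f
cycleFrom-last f a rewrite ≡ᵇ-true {a} refl = refl

cycleFrom-skip : ∀ f a b r {x} → a ≢ x → cycleFrom f (a ∷ b ∷ r) x ≡ cycleFrom f (b ∷ r) x
cycleFrom-skip f a b r a≢x rewrite ≡ᵇ-false a≢x = refl

cycleFrom-chain : ∀ f a l → Unique (a ∷ l) → Chain (cycleFrom f (a ∷ l)) a l f
cycleFrom-chain f a [] _ = cycleFrom-last f a
cycleFrom-chain f a (b ∷ r) (a≢ ∷ unique) =
  cycleFrom-head f a b r , Chain-cong (agree (here refl)) (agree ∘ there) (cycleFrom-chain f b r unique)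
  where
  agree : ∀ {z} → z ∈ b ∷ r → cycleFrom f (b ∷ r) z ≡ cycleFrom f (a ∷ b ∷ r) z
  agree z∈ = sym (cycleFrom-skip f a b r (All.lookup a≢ z∈))

cycleFrom-tail≢second : ∀ f a b r → Unique (a ∷ b ∷ r) → f ∉ b ∷ r → ∀ {y} → y ∈ b ∷ r →
                   cycleFrom f (a ∷ b ∷ r) y ≢ b
cycleFrom-tail≢second f a b r (a≢ ∷ b≢ ∷ u) f∉ y∈ eq
  rewrite cycleFrom-skip f a b r (All.lookup a≢ y∈)
  with Chain-step (cycleFrom-chain f b r (b≢ ∷ u)) y∈
... | inj₁ b∈r = All.lookup b≢ (subst (_∈ r) eq b∈r) refl
... | inj₂ b≡f = f∉ (here (trans (sym b≡f) eq))

cycleFrom-injective : ∀ f a l → Unique (a ∷ l) → f ∉ l → ∀ {x y} → x ∈ a ∷ l → y ∈ a ∷ l →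
                      cycleFrom f (a ∷ l) x ≡ cycleFrom f (a ∷ l) y → x ≡ y
cycleFrom-injective f a [] _ _ (here refl) (here refl) _ = refl
cycleFrom-injective f a (b ∷ r) _ _ (here refl) (here refl) _ = refl
cycleFrom-injective f a (b ∷ r) u f∉ (here refl) (there y∈) eq =
  ⊥-elim (cycleFrom-tail≢second f a b r u f∉ y∈ (trans (sym eq) (cycleFrom-head f a b r)))
cycleFrom-injective f a (b ∷ r) u f∉ (there x∈) (here refl) eq =
  ⊥-elim (cycleFrom-tail≢second f a b r u f∉ x∈ (trans eq (cycleFrom-head f a b r)))
cycleFrom-injective f a (b ∷ r) (a≢ ∷ u) f∉ (there x∈) (there y∈) eq =
  cycleFrom-injective f b r u (f∉ ∘ there) x∈ y∈
    (trans (sym (cycleFrom-skip f a b r (All.lookup a≢ x∈))) (trans eq (cycleFrom-skip f a b r (All.lookup a≢ y∈))))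

module _ {n h t} (h∷t↭ : h ∷ t ↭ upTo (suc n)) where

  private
    ∈⇒≤ : ∀ {x} → x ∈ h ∷ t → x ≤ n
    ∈⇒≤ x∈ = ℕ.≤-pred (∈.∈-upTo⁻ (↭.∈-resp-↭ h∷t↭ x∈))

    ≤⇒∈ : ∀ {x} → x ≤ n → x ∈ h ∷ t
    ≤⇒∈ x≤n = ↭.∈-resp-↭ (↭-sym h∷t↭) (∈.∈-upTo⁺ (s≤s x≤n))

    unique : Unique (h ∷ t)
    unique = Unique-resp-↭ (↭⇒↭ₛ (↭-sym h∷t↭)) (Unique.upTo⁺ (suc n))

    h∉t : h ∉ t
    h∉t = Unique.Unique[x∷xs]⇒x∉xs unique

  cyc-chain : Chain (cyc (h ∷ t)) h t h
  cyc-chain = cycleFrom-chain h h t unique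

  from-head : ∀ {y} → y ∈ h ∷ t → ∃ λ s → fold h (cyc (h ∷ t)) s ≡ y
  from-head (here refl) = 0 , refl
  from-head (there y∈t) = Chain-fromStart cyc-chain y∈t

  cyc-permutes : Permutes n (cyc (h ∷ t))
  cyc-permutes = record
    { closed = λ x≤n → ∈⇒≤ (step (Chain-step cyc-chain (≤⇒∈ x≤n)))
    ; injective = λ x≤n y≤n → cycleFrom-injective h h t unique h∉t (≤⇒∈ x≤n) (≤⇒∈ y≤n)
    }
    where
    step : ∀ {y} → y ∈ t ⊎ y ≡ h → y ∈ h ∷ t
    step (inj₁ y∈t) = there y∈t
    step (inj₂ refl) = here refl

  cyc-reaches : ∀ {x y} → x ≤ n → y ≤ n → ∃ λ s → fold x (cyc (h ∷ t)) s ≡ y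
  cyc-reaches {x} x≤n y≤n with Chain-toEnd cyc-chain (≤⇒∈ x≤n) | from-head (≤⇒∈ y≤n)
  ... | s₁ , x↦h | s₂ , h↦y =
    s₂ + suc s₁ , trans (fold-+ x (cyc (h ∷ t)) s₂) (trans (cong (λ z → fold z (cyc (h ∷ t)) s₂) x↦h) h↦y)

upTo-split : ∀ {x n} → x < n → ∃ λ r → upTo (suc n) ≡ upTo x ++ x ∷ suc x ∷ r
upTo-split {x} {suc n} (s≤s x≤n) with ℕ.m≤n⇒m<n∨m≡n x≤n
... | inj₂ refl = [] , (begin
  upTo (suc (suc x))                 ≡⟨ List.upTo-∷ʳ (suc x) ⟨
  upTo (suc x) ++ [ suc x ]          ≡⟨ cong (_++ [ suc x ]) (List.upTo-∷ʳ x) ⟨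
  (upTo x ++ [ x ]) ++ [ suc x ]     ≡⟨ List.++-assoc (upTo x) [ x ] [ suc x ] ⟩
  upTo x ++ x ∷ suc x ∷ []           ∎)
  where open ≡-Reasoning
... | inj₁ x<n with upTo-split x<n
...   | r , split = r ++ [ suc n ] , (begin
  upTo (suc (suc n))                         ≡⟨ List.upTo-∷ʳ (suc n) ⟨
  upTo (suc n) ++ [ suc n ]                  ≡⟨ cong (_++ [ suc n ]) split ⟩
  (upTo x ++ x ∷ suc x ∷ r) ++ [ suc n ]     ≡⟨ List.++-assoc (upTo x) (x ∷ suc x ∷ r) [ suc n ] ⟩
  upTo x ++ x ∷ suc x ∷ r ++ [ suc n ]       ∎)
  where open ≡-Reasoning

X-permutes : ∀ n → Permutes n (X n)
X-permutes n = cyc-permutes ↭.↭-refl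

X-suc : ∀ {n x} → x < n → X n x ≡ suc x
X-suc {n} {x} x<n with upTo-split x<n
... | r , split = proj₁ (Chain-split (upTo x) (suc x ∷ r) split (cyc-chain {n} ↭.↭-refl))

X-n : ∀ n → X n n ≡ 0
X-n n = Chain-split (upTo n) [] (sym (List.upTo-∷ʳ n)) (cyc-chain {n} ↭.↭-refl)

module _ {n} {π : List ℕ} (π↭ : π ↭ map suc (upTo n)) where

  private
    0∷reverse↭ : 0 ∷ reverse π ↭ upTo (suc n)
    0∷reverse↭ = ↭-prep 0 (↭-trans (↭.↭-reverse π) (↭-trans π↭ (↭-reflexive (List.map-upTo suc n))))

  Y-permutes : Permutes n (Y π)
  Y-permutes = cyc-permutes 0∷reverse↭

  Y-reaches : ∀ {x y} → x ≤ n → y ≤ n → ∃ λ s → fold x (Y π) s ≡ y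
  Y-reaches = cyc-reaches 0∷reverse↭

  C-permutes : Permutes n (C n π)
  C-permutes = Permutes-∘ Y-permutes (X-permutes n)

-- The strategic pile

-- cycleOf0 n π = 0 ∷ excursion (C n π) n 0
excursion : (ℕ → ℕ) → ℕ → ℕ → List ℕ
excursion f n x = takeWhile (λ y → ¬? (y ≟ x)) (map (λ i → iter f (suc i) x) (upTo n))

module _ {n f} (perm : Permutes n f) {x} (x≤n : x ≤ n) where

  excursion-chain : Chain f x (excursion f n x) x
  excursion-chain with returns perm x≤n
  ... | i , i≤n , fⁱ⁺¹x≡x =
    subst (λ l → Chain f x (takeWhile (λ y → ¬? (y ≟ x)) l) x) (sym (List.map-upTo _ n))
      (Chain-takeWhile n (λ _ → refl) refl i≤n (trans (iter≡fold f (suc i) x) fⁱ⁺¹x≡x))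

  excursion-≤ : ∀ {z} → z ∈ x ∷ excursion f n x → z ≤ n
  excursion-≤ (here refl) = x≤n
  excursion-≤ (there z∈) with Chain-fromStart excursion-chain z∈
  ... | t , refl = fold-closed perm t x≤n

  excursion-unique : Unique (x ∷ excursion f n x)
  excursion-unique = Chain-unique
    (λ a∈ b∈ → Permutes.injective perm (excursion-≤ a∈) (excursion-≤ b∈))
    excursion-chain
    (λ x∈ → All.lookup (all-takeWhile (λ y → ¬? (y ≟ x)) (map (λ i → iter f (suc i) x) (upTo n))) x∈ refl)

-- SP n π = after n (cycleOf0 n π)
after : ℕ → List ℕ → List ℕ
after v xs = drop 1 (dropWhile (λ y → ¬? (y ≟ v)) xs)

after-split : ∀ v xs → after v xs ≡ [] ⊎ ∃ λ p → xs ≡ p ++ v ∷ after v xs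
after-split v [] = inj₁ refl
after-split v (x ∷ xs) with x ≟ v
... | yes refl rewrite ≡ᵇ-true {x} refl = inj₂ ([] , refl)
... | no x≢v rewrite ≡ᵇ-false x≢v with after-split v xs
...   | inj₁ none = inj₁ none
...   | inj₂ (p , split) = inj₂ (x ∷ p , cong (x ∷_) split)

Unique-suffix : ∀ p {ys : List ℕ} → Unique (p ++ ys) → Unique ys
Unique-suffix [] u = u
Unique-suffix (_ ∷ p) (_ ∷ u) = Unique-suffix p u

head∉suffix : ∀ {x l} (p : List ℕ) {z} r → Unique (x ∷ l) → x ∷ l ≡ p ++ z ∷ r → x ∉ r
head∉suffix [] r (x≢ ∷ _) refl x∈r = All.lookup x≢ x∈r refl
head∉suffix (_ ∷ p) r (x≢ ∷ _) refl x∈r = All.lookup x≢ (∈.∈-++⁺ʳ p (there x∈r)) refl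

record IsStrategicPile (n : ℕ) (f : ℕ → ℕ) (L : List ℕ) : Set where
  field
    chain : Chain f n L 0
    unique : Unique L
    bounded : All (λ b → 0 < b × b < n) L

SP-isStrategicPile : ∀ {n π} → π ↭ map suc (upTo n) → SP n π ≢ [] → IsStrategicPile n (C n π) (SP n π)
SP-isStrategicPile {n} {π} π↭ SP≢[] with after-split n (cycleOf0 n π)
... | inj₁ SP≡[] = ⊥-elim (SP≢[] SP≡[])
... | inj₂ (p , split) = record
  { chain = Chain-split p (SP n π) split (excursion-chain perm z≤n)
  ; unique = unique
  ; bounded = All.tabulate λ b∈ →
      ℕ.n≢0⇒n>0 (λ { refl → head∉suffix p (SP n π) cycle-unique split b∈ }) ,
      ℕ.≤∧≢⇒< (excursion-≤ perm z≤n (subst (_ ∈_) (sym split) (∈.∈-++⁺ʳ p (there b∈))))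
              (λ { refl → All.lookup n≢ b∈ refl })
  }
  where
  perm = C-permutes π↭
  cycle-unique : Unique (cycleOf0 n π)
  cycle-unique = excursion-unique perm z≤n
  n∷SP-unique : Unique (n ∷ SP n π)
  n∷SP-unique = Unique-suffix p (subst Unique split cycle-unique)
  n≢ = AllPairs.head n∷SP-unique
  unique = AllPairs.tail n∷SP-unique

-- merges n π = mergeCount (SP n π)
mergeCount : List ℕ → ℕ
mergeCount L = length (filter (λ b → suc b ∈? L) L)

maximum : ∀ x xs → ∃ λ M → M ∈ x ∷ xs × All (_≤ M) (x ∷ xs)
maximum x xs = max x xs , max∈ (argmax-sel (λ y → y) x xs) , v≤max⁺ x xs (inj₁ ℕ.≤-refl) ∷ xs≤max x xs
  where
  max∈ : max x xs ≡ x ⊎ max x xs ∈ xs → max x xs ∈ x ∷ xs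
  max∈ (inj₁ M≡x) = here M≡x
  max∈ (inj₂ M∈xs) = there M∈xs

minimum : ∀ x xs → ∃ λ c → c ∈ x ∷ xs × All (c ≤_) (x ∷ xs)
minimum x xs = min x xs , min∈ (argmin-sel (λ y → y) x xs) , min≤v⁺ x xs (inj₁ ℕ.≤-refl) ∷ min≤xs x xs
  where
  min∈ : min x xs ≡ x ⊎ min x xs ∈ xs → min x xs ∈ x ∷ xs
  min∈ (inj₁ c≡x) = here c≡x
  min∈ (inj₂ c∈xs) = there c∈xs

module _ {p} {P : Pred ℕ p} (P? : Decidable P) where

  length-filter-two-fail : ∀ xs {x y} → x ∈ xs → y ∈ xs → x ≢ y → ¬ P x → ¬ P y →
                           2 + length (filter P? xs) ≤ length xs
  length-filter-two-fail (z ∷ xs) (here refl) (here refl) x≢y _ _ = ⊥-elim (x≢y refl)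
  length-filter-two-fail (z ∷ xs) (here refl) (there y∈) _ ¬Px ¬Py with P? z
  ... | yes Pz = ⊥-elim (¬Px Pz)
  ... | no _ = s≤s (List.filter-notAll P? xs (Any.map (λ { refl → ¬Py }) y∈))
  length-filter-two-fail (z ∷ xs) (there x∈) (here refl) _ ¬Px ¬Py with P? z
  ... | yes Pz = ⊥-elim (¬Py Pz)
  ... | no _ = s≤s (List.filter-notAll P? xs (Any.map (λ { refl → ¬Px }) x∈))
  length-filter-two-fail (z ∷ xs) (there x∈) (there y∈) x≢y ¬Px ¬Py with P? z
  ... | yes _ = s≤s (length-filter-two-fail xs x∈ y∈ x≢y ¬Px ¬Py)
  ... | no _ = ℕ.m≤n⇒m≤1+n (length-filter-two-fail xs x∈ y∈ x≢y ¬Px ¬Py)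

mergeCount< : ∀ {L} → L ≢ [] → mergeCount L < length L
mergeCount< {[]} []≢[] = ⊥-elim ([]≢[] refl)
mergeCount< {x ∷ xs} _ with maximum x xs
... | M , M∈ , ≤M =
  List.filter-notAll (λ b → suc b ∈? (x ∷ xs)) (x ∷ xs)
    (Any.map (λ { refl sM∈ → ℕ.<-irrefl refl (All.lookup ≤M sM∈) }) M∈)

IsInterval : ℕ → ℕ → List ℕ → Set
IsInterval c k L = ∀ {x} → x ∈ L ⇔ (c ≤ x × x < c + k)

Unique-length-≤ : ∀ {xs ys : List ℕ} → Unique xs → (∀ {x} → x ∈ xs → x ∈ ys) → length xs ≤ length ys
Unique-length-≤ {[]} _ _ = z≤n
Unique-length-≤ {x ∷ xs} {ys} (x≢ ∷ unique) xs⊆ys with ∈.∈-∃++ (xs⊆ys (here refl))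
... | p , q , refl = subst (suc (length xs) ≤_) (sym (List.length-++-sucʳ p x q))
  (s≤s (Unique-length-≤ unique (λ y∈ → remove (xs⊆ys (there y∈)) (≢-sym (All.lookup x≢ y∈)))))
  where
  remove : ∀ {y} → y ∈ p ++ x ∷ q → y ≢ x → y ∈ p ++ q
  remove y∈ y≢x with ∈.∈-++⁻ p y∈
  ... | inj₁ y∈p = ∈.∈-++⁺ˡ y∈p
  ... | inj₂ (here y≡x) = ⊥-elim (y≢x y≡x)
  ... | inj₂ (there y∈q) = ∈.∈-++⁺ʳ p y∈q

interval-of-successor-closed : ∀ {L c M} → Unique L → c ∈ L → All (c ≤_) L → All (_≤ M) L →
                               (∀ {y} → y ∈ L → y ≢ M → suc y ∈ L) → IsInterval c (length L) L
interval-of-successor-closed {L} {c} {M} unique c∈ c≤ ≤M successor∈ = mk⇔ to from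
  where
  c≤M : c ≤ M
  c≤M = All.lookup ≤M c∈

  upward : ∀ d → c + d ≤ M → c + d ∈ L
  upward zero _ = subst (_∈ L) (sym (ℕ.+-identityʳ c)) c∈
  upward (suc d) c+d<M = subst (_∈ L) (sym (ℕ.+-suc c d))
    (successor∈ (upward d (ℕ.<⇒≤ c+d<M′)) (ℕ.<⇒≢ c+d<M′))
    where
    c+d<M′ : c + d < M
    c+d<M′ = subst (_≤ M) (ℕ.+-suc c d) c+d<M

  range : List ℕ
  range = applyUpTo (c +_) (suc (M ∸ c))

  L⊆range : ∀ {y} → y ∈ L → y ∈ range
  L⊆range y∈ = subst (_∈ range) (ℕ.m+[n∸m]≡n c≤y)
    (∈.∈-applyUpTo⁺ (c +_) (s≤s (ℕ.∸-monoˡ-≤ c (All.lookup ≤M y∈))))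
    where c≤y = All.lookup c≤ y∈

  range⊆L : ∀ {y} → y ∈ range → y ∈ L
  range⊆L y∈ with ∈.∈-applyUpTo⁻ (c +_) y∈
  ... | i , s≤s i≤M-c , refl = upward i (subst (c + i ≤_) (ℕ.m+[n∸m]≡n c≤M) (ℕ.+-monoʳ-≤ c i≤M-c))

  range-unique : Unique range
  range-unique = Unique.applyUpTo⁺₁ (c +_) (suc (M ∸ c)) (λ i<j _ → ℕ.<⇒≢ (ℕ.+-monoʳ-< c i<j))

  length≡ : length L ≡ suc (M ∸ c)
  length≡ = ℕ.≤-antisym
    (subst (length L ≤_) (List.length-applyUpTo (c +_) (suc (M ∸ c))) (Unique-length-≤ unique L⊆range))
    (subst (_≤ length L) (List.length-applyUpTo (c +_) (suc (M ∸ c)))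
      (Unique-length-≤ range-unique range⊆L))

  c+length≡ : c + length L ≡ suc M
  c+length≡ = trans (cong (c +_) length≡) (trans (ℕ.+-suc c (M ∸ c)) (cong suc (ℕ.m+[n∸m]≡n c≤M)))

  to : ∀ {y} → y ∈ L → c ≤ y × y < c + length L
  to {y} y∈ = All.lookup c≤ y∈ , subst (y <_) (sym c+length≡) (s≤s (All.lookup ≤M y∈))

  from : ∀ {y} → c ≤ y × y < c + length L → y ∈ L
  from {y} (c≤y , y<) = subst (_∈ L) (ℕ.m+[n∸m]≡n c≤y)
    (upward (y ∸ c) (subst (_≤ M) (sym (ℕ.m+[n∸m]≡n c≤y)) (ℕ.≤-pred (subst (y <_) c+length≡ y<))))

interval-of-mergeCount : ∀ {L} → L ≢ [] → Unique L → length L ≤ suc (mergeCount L) →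
                         ∃ λ c → IsInterval c (length L) L
interval-of-mergeCount {[]} []≢[] _ _ = ⊥-elim ([]≢[] refl)
interval-of-mergeCount {x ∷ xs} _ unique few-gaps with maximum x xs | minimum x xs
... | M , M∈ , ≤M | c , c∈ , c≤ = c , interval-of-successor-closed unique c∈ c≤ ≤M successor∈
  where
  L = x ∷ xs
  -- y and the maximum both without successor would leave two entries uncounted
  successor∈ : ∀ {y} → y ∈ L → y ≢ M → suc y ∈ L
  successor∈ {y} y∈ y≢M with suc y ∈? L
  ... | yes sy∈ = sy∈
  ... | no sy∉ = ⊥-elim (ℕ.<-irrefl refl (ℕ.≤-trans
    (length-filter-two-fail (λ b → suc b ∈? L) L y∈ M∈ y≢M sy∉ sM∉) few-gaps))
    where
    sM∉ : suc M ∉ L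
    sM∉ sM∈ = ℕ.<-irrefl refl (All.lookup ≤M sM∈)

-- A strategic pile forming an interval has odd length

bump : ℕ → ℕ
bump zero = zero
bump (suc x) = suc (suc x)

bump-injective : ∀ {x y} → bump x ≡ bump y → x ≡ y
bump-injective {zero} {zero} _ = refl
bump-injective {suc x} {suc y} eq = cong suc (ℕ.suc-injective (ℕ.suc-injective eq))

bump-pred : ∀ {x} → x ≢ 1 → bump (pred x) ≡ x
bump-pred {zero} _ = refl
bump-pred {suc zero} x≢1 = ⊥-elim (x≢1 refl)
bump-pred {suc (suc x)} _ = refl

Cyclic-transport : ∀ {N} {G : ℕ → Set} (φ : ℕ → Fin N) (g : ℕ → ℕ) {h : Fin N → Fin N} {p} →
                   (∀ i → ∃ λ x → G x × φ x ≡ i) →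
                   (∀ {x} → G x → x ≢ p → G (g x) × h (φ x) ≡ φ (g x)) →
                   (∀ {x} → G x → ∃ λ s → fold x g s ≡ p) →
                   Cyclic h
Cyclic-transport {G = G} φ g {h} {p} φ-onto step reaches = φ p , λ i → lift-reach (φ-onto i)
  where
  go : ∀ s {x} → G x → fold x g s ≡ p → ∃ λ t → fold (φ x) h t ≡ φ p
  go zero _ refl = 0 , refl
  go (suc s) {x} Gx gˢ⁺¹x≡p with x ≟ p
  ... | yes refl = 0 , refl
  ... | no x≢p with step Gx x≢p
  ...   | Ggx , hφx≡φgx with go s Ggx (trans (sym (fold-suc g x s)) gˢ⁺¹x≡p)
  ...     | t , hᵗφgx≡φp =
    suc t , trans (fold-suc h (φ x) t) (trans (cong (λ w → fold w h t) hφx≡φgx) hᵗφgx≡φp)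
  lift-reach : ∀ {i} → ∃ (λ x → G x × φ x ≡ i) → ∃ λ t → fold i h t ≡ φ p
  lift-reach (x , Gx , refl) = go (proj₁ (reaches Gx)) Gx (proj₂ (reaches Gx))

module _ {n} {Y : ℕ → ℕ} (Y-permutes : Permutes n Y)
         (Y-reaches : ∀ {x y} → x ≤ n → y ≤ n → ∃ λ s → fold x Y s ≡ y)
         {L} (pile : IsStrategicPile n (Y ∘ X n) L) {c m} (interval : IsInterval c (suc m) L) where

  open IsStrategicPile pile
  open Permutes Y-permutes using () renaming (injective to Y-injective)

  private
    k = suc m

    in-interval : ∀ {x} → x ∈ L → c ≤ x × x < c + k
    in-interval = Equivalence.to interval

    interval⊆L : ∀ {x} → c ≤ x → x < c + k → x ∈ L
    interval⊆L c≤x x<c+k = Equivalence.from interval (c≤x , x<c+k)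

    c∈L : c ∈ L
    c∈L = interval⊆L ℕ.≤-refl (ℕ.m<m+n c (s≤s z≤n))

    0<c : 0 < c
    0<c = proj₁ (All.lookup bounded c∈L)

    L-<n : ∀ {b} → b ∈ L → b < n
    L-<n = proj₂ ∘ All.lookup bounded

  -- the points of the cycle (0 b₁ ⋯ bₖ) of τ, indexed by Fin (k + 1)
  G : ℕ → Set
  G x = x ≡ 0 ⊎ x ∈ L

  G-≤ : ∀ {x} → G x → x ≤ n
  G-≤ (inj₁ refl) = z≤n
  G-≤ (inj₂ x∈L) = ℕ.<⇒≤ (L-<n x∈L)

  ψ : Fin (suc k) → ℕ
  ψ zero = 0
  ψ (suc i) = c + toℕ i

  -- inverse of ψ on G; the truncation to k only matters outside G
  φ : ℕ → Fin (suc k)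
  φ x = Fin.fromℕ< (s≤s (ℕ.m⊓n≤n (suc x ∸ c) k))

  toℕ-φ : ∀ {x} → suc x ∸ c ≤ k → toℕ (φ x) ≡ suc x ∸ c
  toℕ-φ {x} ≤k = trans (Fin.toℕ-fromℕ< _) (ℕ.m≤n⇒m⊓n≡m ≤k)

  ψ-G : ∀ i → G (ψ i)
  ψ-G zero = inj₁ refl
  ψ-G (suc i) = inj₂ (interval⊆L (ℕ.m≤m+n c (toℕ i)) (ℕ.+-monoʳ-< c (Fin.toℕ<n i)))

  φ-ψ : ∀ i → φ (ψ i) ≡ i
  φ-ψ zero = Fin.toℕ-injective (trans (toℕ-φ (subst (_≤ k) (sym 1∸c≡0) z≤n)) 1∸c≡0)
    where
    1∸c≡0 : 1 ∸ c ≡ 0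
    1∸c≡0 = ℕ.m≤n⇒m∸n≡0 0<c
  φ-ψ (suc i) = Fin.toℕ-injective (trans (toℕ-φ ≤k) suc-c+i∸c)
    where
    suc-c+i∸c : suc (c + toℕ i) ∸ c ≡ suc (toℕ i)
    suc-c+i∸c = trans (cong (_∸ c) (sym (ℕ.+-suc c (toℕ i)))) (ℕ.m+n∸m≡n c (suc (toℕ i)))
    ≤k : suc (c + toℕ i) ∸ c ≤ k
    ≤k = subst (_≤ k) (sym suc-c+i∸c) (Fin.toℕ<n i)

  ψ-onto : ∀ {x} → G x → ∃ λ i → ψ i ≡ x
  ψ-onto (inj₁ refl) = zero , refl
  ψ-onto {x} (inj₂ x∈L) with in-interval x∈L
  ... | c≤x , x<c+k = suc (Fin.fromℕ< x∸c<k) , trans (cong (c +_) (Fin.toℕ-fromℕ< x∸c<k)) (ℕ.m+[n∸m]≡n c≤x)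
    where
    x∸c<k : x ∸ c < k
    x∸c<k = subst (x ∸ c <_) (ℕ.m+n∸m≡n c k) (ℕ.∸-monoˡ-< x<c+k c≤x)

  ψ-φ : ∀ {x} → G x → ψ (φ x) ≡ x
  ψ-φ Gx with ψ-onto Gx
  ... | i , refl = cong ψ (φ-ψ i)

  φ-onto : ∀ i → ∃ λ x → G x × φ x ≡ i
  φ-onto i = ψ i , ψ-G i , φ-ψ i

  τ : ℕ → ℕ
  τ = Y ∘ bump

  τ-chain : Chain τ 0 L 0
  τ-chain = Chain-cong (cong Y (X-n n)) (λ b∈ → C≗τ (All.lookup bounded b∈)) chain
    where
    C≗τ : ∀ {b} → 0 < b × b < n → Y (X n b) ≡ τ b
    C≗τ {suc b} (_ , b<n) = cong Y (X-suc b<n)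

  G⇒∈ : ∀ {x} → G x → x ∈ 0 ∷ L
  G⇒∈ (inj₁ refl) = here refl
  G⇒∈ (inj₂ x∈L) = there x∈L

  τ-G : ∀ {x} → G x → G (τ x)
  τ-G Gx with Chain-step τ-chain (G⇒∈ Gx)
  ... | inj₁ τx∈L = inj₂ τx∈L
  ... | inj₂ τx≡0 = inj₁ τx≡0

  bump-≤ : ∀ {x} → G x → bump x ≤ n
  bump-≤ {zero} _ = z≤n
  bump-≤ {suc x} (inj₂ x∈L) = L-<n x∈L

  τ-injective : ∀ {x y} → G x → G y → τ x ≡ τ y → x ≡ y
  τ-injective Gx Gy τx≡τy = bump-injective (Y-injective (bump-≤ Gx) (bump-≤ Gy) τx≡τy)

  τ̂ : Fin (suc k) → Fin (suc k)
  τ̂ i = φ (τ (ψ i))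

  τ̂-injective : Injective _≡_ _≡_ τ̂
  τ̂-injective {i} {j} τ̂i≡τ̂j = trans (sym (φ-ψ i)) (trans (cong φ ψi≡ψj) (φ-ψ j))
    where
    ψi≡ψj = τ-injective (ψ-G i) (ψ-G j)
      (trans (sym (ψ-φ (τ-G (ψ-G i)))) (trans (cong ψ τ̂i≡τ̂j) (ψ-φ (τ-G (ψ-G j)))))

  τ̂-cyclic : Cyclic τ̂
  τ̂-cyclic = Cyclic-transport φ τ φ-onto (λ Gx _ → τ-G Gx , cong (φ ∘ τ) (ψ-φ Gx))
    (λ Gx → let t , τᵗ⁺¹x≡0 = Chain-toEnd τ-chain (G⇒∈ Gx) in suc t , τᵗ⁺¹x≡0)

  ψ-rotate : ∀ i → ψ i ≢ c → ψ (lift 1 rotate i) ≡ pred (ψ i)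
  ψ-rotate zero _ = refl
  ψ-rotate (suc zero) ψi≢c = ⊥-elim (ψi≢c (ℕ.+-identityʳ c))
  ψ-rotate (suc (suc i)) _ = trans (cong (c +_) (Fin.toℕ-inject₁ i)) (cong pred (sym (ℕ.+-suc c (toℕ i))))

  pred-∈ : ∀ {x} → c < x → x < c + k → pred x ∈ L
  pred-∈ {suc x} (s≤s c≤x) x<c+k = interval⊆L c≤x (ℕ.<-trans (ℕ.n<1+n x) x<c+k)

  above-c : ∀ {x} → x ∈ L → x ≢ c → c < x
  above-c x∈L x≢c = ℕ.≤∧≢⇒< (proj₁ (in-interval x∈L)) (x≢c ∘ sym)

  G-≢1 : ∀ {x} → G x → x ≢ c → x ≢ 1
  G-≢1 (inj₂ 1∈L) 1≢c refl = ℕ.<-irrefl refl (ℕ.<-≤-trans 0<c (ℕ.≤-pred (above-c 1∈L 1≢c)))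

  G-pred : ∀ {x} → G x → x ≢ c → G (pred x)
  G-pred (inj₁ refl) _ = inj₁ refl
  G-pred (inj₂ x∈L) x≢c = inj₂ (pred-∈ (above-c x∈L x≢c) (proj₂ (in-interval x∈L)))

  Y-step : ∀ {x} → G x → x ≢ c → G (Y x) × τ̂ (lift 1 rotate (φ x)) ≡ φ (Y x)
  Y-step {x} Gx x≢c = subst G τ-pred≡Y (τ-G (G-pred Gx x≢c)) , cong φ (begin
    τ (ψ (lift 1 rotate (φ x)))    ≡⟨ cong τ (ψ-rotate (φ x) (x≢c ∘ trans (sym (ψ-φ Gx)))) ⟩
    τ (pred (ψ (φ x)))             ≡⟨ cong (τ ∘ pred) (ψ-φ Gx) ⟩
    τ (pred x)                     ≡⟨ τ-pred≡Y ⟩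
    Y x                            ∎)
    where
    open ≡-Reasoning
    τ-pred≡Y : τ (pred x) ≡ Y x
    τ-pred≡Y = cong Y (bump-pred (G-≢1 Gx x≢c))

  interval-pile-odd : parity m ≡ 0ℙ
  interval-pile-odd = cyclic-∘-lift-rotate τ̂-injective τ̂-cyclic
    (Cyclic-transport φ Y φ-onto Y-step (λ Gx → Y-reaches (G-≤ Gx) (ℕ.<⇒≤ (L-<n c∈L))))

even⇒parity≡0ℙ : ∀ n → n % 2 ≡ 0 → parity n ≡ 0ℙ
even⇒parity≡0ℙ zero _ = refl
even⇒parity≡0ℙ (suc zero) ()
even⇒parity≡0ℙ (suc (suc n)) even =
  even⇒parity≡0ℙ n (trans (sym ([m+n]%n≡m%n n 2)) (trans (cong (_% 2) (ℕ.+-comm n 2)) even))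

parity≡0ℙ⇒suc%2≢0 : ∀ m → parity m ≡ 0ℙ → suc m % 2 ≢ 0
parity≡0ℙ⇒suc%2≢0 m parity≡0 even
  with trans (cong _⁻¹ (sym (even⇒parity≡0ℙ (suc m) even))) (trans (ℙ.suc-homo-⁻¹ m) parity≡0)
... | ()

lemma5p9 : (n k : ℕ) (π : List ℕ) → π ↭ map suc (upTo n) → 1 ≤ k →
    length (SP n π) ≡ k →
    (k % 2 ≡ 1 → merges n π ≤ k ∸ 1) × (k % 2 ≡ 0 → merges n π ≤ k ∸ 2)
lemma5p9 n (suc m) π π↭ _ |SP|≡k = (λ _ → merges≤k-1) , merges≤k-2
  where
  SP≢[] : SP n π ≢ []
  SP≢[] SP≡[] = ℕ.0≢1+n (trans (sym (cong length SP≡[])) |SP|≡k)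
  pile : IsStrategicPile n (C n π) (SP n π)
  pile = SP-isStrategicPile π↭ SP≢[]
  merges≤k-1 : merges n π ≤ m
  merges≤k-1 = ℕ.≤-pred (subst (merges n π <_) |SP|≡k (mergeCount< SP≢[]))
  merges≤k-2 : suc m % 2 ≡ 0 → merges n π ≤ m ∸ 1
  merges≤k-2 even with merges n π ℕ.≤? m ∸ 1
  ... | yes ≤k-2 = ≤k-2
  ... | no ≰k-2 =
    ⊥-elim (parity≡0ℙ⇒suc%2≢0 m (interval-pile-odd (Y-permutes π↭) (Y-reaches π↭) pile (proj₂ interval)) even)
    where
    few-gaps : length (SP n π) ≤ suc (merges n π)
    few-gaps = subst (_≤ suc (merges n π)) (sym |SP|≡k) (s≤s (ℕ.≤-trans (ℕ.m≤n+m∸n m 1) (ℕ.≰⇒> ≰k-2)))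
    interval : ∃ λ c → IsInterval c (suc m) (SP n π)
    interval = subst (λ k → ∃ λ c → IsInterval c k (SP n π)) |SP|≡k
      (interval-of-mergeCount SP≢[] (IsStrategicPile.unique pile) few-gaps)
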